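{- Let $\mathbb{F}$ be a field, $A\in\mathbb{F}^{n\times n}$ with columns $a_1,\dots,a_n$, and suppose $Z=[k]$ is a zero forcing set of $A$ with a fixed chronological list of forces $\pi$. Let $r=\operatorname{rank}(A)$, $A''=[a_{k+1}\ \cdots\ a_n]\in\mathbb{F}^{n\times(n-k)}$, and let $p=r-(n-k)$ and $A'_1=[a_1\ \cdots\ a_p]$ be such that $\operatorname{rank}(A'_1)=p$ and $\operatorname{rank}([A'_1\ A''])=r$. Let $R:\mathbb{F}^n\to\mathbb{F}^n$ be the (linear) map $R(b)=b-A\,\textsc{Forcing}(A,Z,b)$, also viewed as a matrix. Then $\operatorname{rank}(RA'_1)=\operatorname{rank}(A'_1)$.
   Context: Let $G=(V,E)$, $V=[n]$, be the directed graph with $(u,v)\in E$ iff $u\neq v$ and $A_{u,v}\neq0$. Zero forcing: starting from a blue set $Z$, a blue vertex with exactly one non-blue out-neighbour $u$ forces $u$ (colours it blue); $Z$ is a zero forcing set if this eventually colours all of $V$ blue. A chronological list of forces $\pi$ is an ordering $u_1,\dots,u_{n-|Z|}$ of $V\setminus Z$ together with, for each $u_i$, a forcing parent $u_i^{\uparrow}\in Z\cup\{u_1,\dots,u_{i-1}\}$ such that $u_i$ is the only out-neighbour of $u_i^{\uparrow}$ outside $Z\cup\{u_1,\dots,u_{i-1}\}$ (so $A_{u_i^{\uparrow},u_i}\neq0$). The procedure $\textsc{Forcing}(A,Z,b)$ (using $\pi$): set $x\gets0$; for each $u\in V\setminus Z$ in the order $\pi$, set $x_u\gets (b_{u^{\uparrow}}-A_{u^{\uparrow},*}x)/A_{u^{\uparrow},u}$,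 where $A_{w,*}$ is row $w$ of $A$; return $x$. (The columns of $A$ outside a zero forcing set are linearly independent, so $r\ge n-k$.) -}

module Defs where

open import Level using (Level; _⊔_; suc)
open import Data.Nat using (ℕ; _≤_) renaming (_+_ to _+ℕ_)
import Data.Nat as ℕ
open import Data.Fin using (Fin; toℕ; _↑ˡ_; _↑ʳ_; inject≤; splitAt)
open import Data.Sum using (_⊎_; [_,_])
open import Data.Product using (Σ; ∃; _×_; _,_)
open import Data.Vec.Functional using (Vector; foldr; foldl; updateAt)
open import Function using (const; Injective)
open import Relation.Binary.PropositionalEquality using (_≡_)
open import Relation.Nullary using (¬_)
open import Algebra.Bundles using (CommutativeRing)

-- A field: a commutative ring with 0 ≉ 1 in which every nonzero element has
-- a multiplicative inverse (the inverse is a total operation, its value at 0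
-- is irrelevant).
record Field c ℓ : Set (suc (c ⊔ ℓ)) where
  field
    commutativeRing : CommutativeRing c ℓ
  open CommutativeRing commutativeRing public
  field
    _⁻¹      : Carrier → Carrier
    0≉1      : ¬ (0# ≈ 1#)
    ⁻¹-inverse : ∀ x → ¬ (x ≈ 0#) → (x * (x ⁻¹)) ≈ 1#

module _ {c ℓ} (F : Field c ℓ) where
  open Field F

  Matrix : ℕ → ℕ → Set c
  Matrix r s = Fin r → Fin s → Carrier

  sumᶠ : ∀ {n} → Vector Carrier n → Carrier
  sumᶠ v = foldr _+_ 0# v

  _·_ : ∀ {r s} → Matrix r s → Vector Carrier s → Vector Carrier r
  (M · x) i = sumᶠ (λ j → M i j * x j)

  column : ∀ {r s} → Matrix r s → Fin s → Vector Carrier r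
  column M j i = M i j

  selectCols : ∀ {r s t} → Matrix r s → (Fin t → Fin s) → Matrix r t
  selectCols M sel i j = M i (sel j)

  ColumnsIndependent : ∀ {r s} → Matrix r s → Set (c ⊔ ℓ)
  ColumnsIndependent {r} {s} M =
    ∀ (γ : Vector Carrier s) → (∀ i → (M · γ) i ≈ 0#) → ∀ j → γ j ≈ 0#

  HasRank : ∀ {r s} → Matrix r s → ℕ → Set (c ⊔ ℓ)
  HasRank {r} {s} M t =
    (Σ (Fin t → Fin s) λ sel → ColumnsIndependent (selectCols M sel))
    × (∀ (sel : Fin (ℕ.suc t) → Fin s) → ¬ ColumnsIndependent (selectCols M sel))

  -- Zero forcing with Z = [k] on vertex set Fin (k +ℕ m).
  -- Z = { i ↑ˡ m | i : Fin k }, i.e. the vertices with index < k.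
  InZ : ∀ {k m} → Fin (k +ℕ m) → Set
  InZ {k} w = toℕ w ℕ.< k

  -- A chronological list of forces for Z = [k]: an ordering
  -- order 0, …, order (m-1) of V ∖ Z, and forcing parents.
  record ChronList {k m : ℕ} (A : Matrix (k +ℕ m) (k +ℕ m)) : Set (c ⊔ ℓ) where
    field
      order  : Fin m → Fin (k +ℕ m)
      parent : Fin m → Fin (k +ℕ m)
      order-injective : Injective _≡_ _≡_ order
      order-notInZ    : ∀ t → ¬ InZ {k} {m} (order t)
      order-covers    : ∀ w → ¬ InZ {k} {m} w → ∃ λ t → order t ≡ w
    BlueBefore : Fin m → Fin (k +ℕ m) → Set
    BlueBefore t w = InZ {k} {m} w ⊎ ∃ λ s → (toℕ s ℕ.< toℕ t) × (order s ≡ w)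
    field
      parent-blue    : ∀ t → BlueBefore t (parent t)
      parent-edge    : ∀ t → ¬ (A (parent t) (order t) ≈ 0#)
      -- order t is the only out-neighbour of parent t that is not yet blue
      parent-unique  : ∀ t w → ¬ (w ≡ parent t) → ¬ (A (parent t) w ≈ 0#) →
                       (w ≡ order t) ⊎ BlueBefore t w

  forcing : ∀ {k m} (A : Matrix (k +ℕ m) (k +ℕ m)) → ChronList {k} {m} A →
            Vector Carrier (k +ℕ m) → Vector Carrier (k +ℕ m)
  forcing {k} {m} A π b = foldl step (const 0#) {m} (λ t → t)
    where
      open ChronList π
      step : Vector Carrier (k +ℕ m) → Fin m → Vector Carrier (k +ℕ m)
      step x t = updateAt x (order t)
        (const ((b (parent t) - (A · x) (parent t)) * (A (parent t) (order t) ⁻¹)))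

  residual : ∀ {k m} (A : Matrix (k +ℕ m) (k +ℕ m)) → ChronList {k} {m} A →
             Vector Carrier (k +ℕ m) → Vector Carrier (k +ℕ m)
  residual {k} {m} A π b i = b i - (A · forcing {k} {m} A π b) i

  -- column indices of [A'_1 A''] : first p columns, then the last m columns
  firstCols : ∀ {p k} m → p ≤ k → Fin p → Fin (k +ℕ m)
  firstCols m p≤k j = inject≤ j p≤k ↑ˡ m

  lastCols : ∀ k {m} → Fin m → Fin (k +ℕ m)
  lastCols k j = k ↑ʳ j

  joinCols : ∀ {p k} m → p ≤ k → Fin (p +ℕ m) → Fin (k +ℕ m)
  joinCols {p} {k} m p≤k j = [ firstCols m p≤k , lastCols k ] (splitAt p j)

-- Forcing(A, Z, b) only ever writes entries outside Z = [k], so A · Forcing(A, Z, b) is a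
-- combination of the columns of A''. Hence if R A'₁ γ = 0, then A'₁ γ = A'' y for some y,
-- i.e. [A'₁ A''] (γ, -y) = 0. Since rank [A'₁ A''] = r = p + (n - k) equals its number of
-- columns, these columns are independent, so γ = 0 and the p columns of R A'₁ are
-- independent.
module Submission where

open import Defs
open import Data.Nat as ℕ using (ℕ; zero; suc; _≤_)
open import Data.Nat.Properties using (n<1+n; 1+n≰n)
open import Data.Fin using (Fin; zero; suc; _↑ˡ_; _↑ʳ_; punchOut)
open import Data.Fin.Properties
  using (_≟_; any?; punchOut-injective; injective⇒≤; pigeonhole; toℕ-↑ˡ; toℕ<n; <⇒≢)
open import Data.Fin.Permutation as Perm using (Permutation; _⟨$⟩ʳ_; _⟨$⟩ˡ_)
open import Data.Product using (_,_; proj₁; proj₂)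
open import Data.Vec.Functional using (Vector; foldl; updateAt; _++_)
open import Data.Vec.Functional.Properties using (updateAt-minimal; lookup-++ˡ; lookup-++ʳ)
open import Function using (Injective; _∘_; const)
open import Function.Definitions using (StrictlySurjective)
open import Function.Bundles using (mk↔ₛ′)
open import Relation.Binary.PropositionalEquality as ≡ using (_≡_; _≢_)
open import Relation.Nullary using (¬_; yes; no)
open import Relation.Nullary.Negation using (contradiction)
import Algebra.Properties.Semiring.Sum as SemiringSum
import Algebra.Properties.Ring as RingProperties

injective⇒strictlySurjective : ∀ {n} {f : Fin n → Fin n} →
  Injective _≡_ _≡_ f → StrictlySurjective _≡_ f
injective⇒strictlySurjective {zero} inj ()
injective⇒strictlySurjective {suc n} {f} inj y with any? (λ x → f x ≟ y)
... | yes hit = hit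
... | no miss = contradiction (injective⇒≤ {f = g} g-injective) 1+n≰n
  where
  y≢f : ∀ x → y ≢ f x
  y≢f x y≡fx = miss (x , ≡.sym y≡fx)
  g : Fin (suc n) → Fin n
  g x = punchOut (y≢f x)
  g-injective : Injective _≡_ _≡_ g
  g-injective eq = inj (punchOut-injective (y≢f _) (y≢f _) eq)

injective⇒permutation : ∀ {n} {f : Fin n → Fin n} → Injective _≡_ _≡_ f → Permutation n n
injective⇒permutation {n} {f} inj = mk↔ₛ′ f f⁻¹ f∘f⁻¹ (λ x → inj (f∘f⁻¹ (f x)))
  where
  f⁻¹ : Fin n → Fin n
  f⁻¹ y = proj₁ (injective⇒strictlySurjective inj y)
  f∘f⁻¹ : ∀ y → f (f⁻¹ y) ≡ y
  f∘f⁻¹ y = proj₂ (injective⇒strictlySurjective inj y)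

foldl-preserves : ∀ {a b q} {A : Set a} {B : Set b} (Q : B → Set q) (f : B → A → B) →
  (∀ z x → Q z → Q (f z x)) → ∀ {n} z (xs : Vector A n) → Q z → Q (foldl f z xs)
foldl-preserves Q f pres {zero}  z xs qz = qz
foldl-preserves Q f pres {suc n} z xs qz =
  foldl-preserves Q f pres (f z (xs zero)) (xs ∘ suc) (pres z (xs zero) qz)

module _ {c ℓ} (F : Field c ℓ) where
  open Field F hiding (zero)
  open SemiringSum semiring
  open RingProperties ring
  open import Relation.Binary.Reasoning.Setoid setoid

  infixr 8 _⊙_
  _⊙_ : ∀ {r s} → Matrix F r s → Vector Carrier s → Vector Carrier r
  _⊙_ = _·_ F

  sum-zero : ∀ {n} {v : Vector Carrier n} → (∀ j → v j ≈ 0#) → sum v ≈ 0#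
  sum-zero {n} v≈0 = trans (sum-cong-≋ v≈0) (sum-replicate-zero n)

  sum-neg : ∀ {n} (v : Vector Carrier n) → sum (λ j → - v j) ≈ - sum v
  sum-neg v = begin
    sum (λ j → - v j)      ≈⟨ sum-cong-≋ (λ j → -1*x≈-x (v j)) ⟨
    sum (λ j → - 1# * v j) ≈⟨ *-distribˡ-sum (- 1#) v ⟨
    - 1# * sum v           ≈⟨ -1*x≈-x (sum v) ⟩
    - sum v                ∎

  ∑-distrib-− : ∀ {n} (u v : Vector Carrier n) → sum (λ j → u j - v j) ≈ sum u - sum v
  ∑-distrib-− u v = trans (∑-distrib-+ u (λ j → - v j)) (+-congˡ (sum-neg v))

  sum-splitAt : ∀ k {m} (v : Vector Carrier (k ℕ.+ m)) →
    sum v ≈ sum (λ i → v (i ↑ˡ m)) + sum (λ j → v (k ↑ʳ j))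
  sum-splitAt zero    v = sym (+-identityˡ _)
  sum-splitAt (suc k) v = trans (+-congˡ (sum-splitAt k (v ∘ suc))) (sym (+-assoc _ _ _))

  δ : ∀ {n} → Fin n → Fin n → Carrier
  δ zero    zero    = 1#
  δ zero    (suc _) = 0#
  δ (suc _) zero    = 0#
  δ (suc a) (suc j) = δ a j

  δ-diag : ∀ {n} (a : Fin n) → δ a a ≡ 1#
  δ-diag zero    = ≡.refl
  δ-diag (suc a) = δ-diag a

  δ-offDiag : ∀ {n} {a b : Fin n} → a ≢ b → δ a b ≡ 0#
  δ-offDiag {a = zero}  {zero}  a≢b = contradiction ≡.refl a≢b
  δ-offDiag {a = zero}  {suc b} a≢b = ≡.refl
  δ-offDiag {a = suc a} {zero}  a≢b = ≡.refl
  δ-offDiag {a = suc a} {suc b} a≢b = δ-offDiag (a≢b ∘ ≡.cong suc)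

  sum-*δ : ∀ {n} (v : Vector Carrier n) (a : Fin n) → sum (λ j → v j * δ a j) ≈ v a
  sum-*δ {suc n} v zero =
    trans (+-cong (*-identityʳ (v zero)) (sum-zero (λ j → zeroʳ (v (suc j))))) (+-identityʳ _)
  sum-*δ {suc n} v (suc a) =
    trans (+-cong (zeroʳ (v zero)) (sum-*δ (v ∘ suc) a)) (+-identityˡ _)

  module _ {r s : ℕ} where

    ⊙-distrib-− : ∀ (M N : Matrix F r s) γ i →
      ((λ i′ j → M i′ j - N i′ j) ⊙ γ) i ≈ (M ⊙ γ) i - (N ⊙ γ) i
    ⊙-distrib-− M N γ i = trans (sum-cong-≋ (λ j → [y-z]x≈yx-zx (γ j) (M i j) (N i j)))
                                (∑-distrib-− (λ j → M i j * γ j) (λ j → N i j * γ j))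

    ⊙-neg : ∀ (M : Matrix F r s) v i → (M ⊙ (λ j → - v j)) i ≈ - (M ⊙ v) i
    ⊙-neg M v i = trans (sum-cong-≋ (λ j → sym (-‿distribʳ-* (M i j) (v j))))
                        (sum-neg (λ j → M i j * v j))

    ⊙-assoc : ∀ {t} (M : Matrix F r s) (N : Matrix F s t) γ i →
      ((λ i′ j → (M ⊙ column F N j) i′) ⊙ γ) i ≈ (M ⊙ (N ⊙ γ)) i
    ⊙-assoc M N γ i = begin
      sum (λ j → sum (λ w → M i w * N w j) * γ j)
        ≈⟨ sum-cong-≋ (λ j → *-distribʳ-sum (γ j) (λ w → M i w * N w j)) ⟩
      sum (λ j → sum (λ w → M i w * N w j * γ j))
        ≈⟨ ∑-comm (λ j w → M i w * N w j * γ j) ⟩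
      sum (λ w → sum (λ j → M i w * N w j * γ j))
        ≈⟨ sum-cong-≋ (λ w → trans (sum-cong-≋ (λ j → *-assoc (M i w) (N w j) (γ j)))
                                   (sym (*-distribˡ-sum (M i w) (λ j → N w j * γ j)))) ⟩
      sum (λ w → M i w * sum (λ j → N w j * γ j)) ∎

    ⊙-++ : ∀ {p q} (M : Matrix F r s) (sel₁ : Fin p → Fin s) (sel₂ : Fin q → Fin s) u v i →
      (selectCols F M (sel₁ ++ sel₂) ⊙ (u ++ v)) i
        ≈ (selectCols F M sel₁ ⊙ u) i + (selectCols F M sel₂ ⊙ v) i
    ⊙-++ {p} M sel₁ sel₂ u v i =
      trans (sum-splitAt p (λ j → M i ((sel₁ ++ sel₂) j) * (u ++ v) j))
            (+-cong (sum-cong-≋ (λ j → reflexive (≡.cong₂ (λ w x → M i w * x)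
                                   (lookup-++ˡ sel₁ sel₂ j) (lookup-++ˡ u v j))))
                    (sum-cong-≋ (λ j → reflexive (≡.cong₂ (λ w x → M i w * x)
                                   (lookup-++ʳ sel₁ sel₂ j) (lookup-++ʳ u v j)))))

  ⊙-vanishingOnFirst : ∀ {r} k {m} (M : Matrix F r (k ℕ.+ m)) x →
    (∀ w → x (w ↑ˡ m) ≈ 0#) →
    ∀ i → (M ⊙ x) i ≈ (selectCols F M (lastCols F k) ⊙ (x ∘ lastCols F k)) i
  ⊙-vanishingOnFirst k {m} M x x≈0 i = begin
    (M ⊙ x) i
      ≈⟨ sum-splitAt k (λ w → M i w * x w) ⟩
    sum (λ w → M i (w ↑ˡ m) * x (w ↑ˡ m)) + sum (λ l → M i (k ↑ʳ l) * x (k ↑ʳ l))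
      ≈⟨ +-congʳ (sum-zero (λ w → trans (*-congˡ (x≈0 w)) (zeroʳ _))) ⟩
    0# + sum (λ l → M i (k ↑ʳ l) * x (k ↑ʳ l))
      ≈⟨ +-identityˡ _ ⟩
    (selectCols F M (lastCols F k) ⊙ (x ∘ lastCols F k)) i ∎

  repeatedColumn⇒dependent : ∀ {r s t} (M : Matrix F r s) (sel : Fin t → Fin s) {a b : Fin t} →
    a ≢ b → sel a ≡ sel b → ¬ ColumnsIndependent F (selectCols F M sel)
  repeatedColumn⇒dependent M sel {a} {b} a≢b sela≡selb independent = 0≉1 (sym 1≈0)
    where
    γ : Vector Carrier _
    γ j = δ a j - δ b j
    kernel : ∀ i → (selectCols F M sel ⊙ γ) i ≈ 0#
    kernel i = begin
      sum (λ j → M i (sel j) * (δ a j - δ b j))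
        ≈⟨ sum-cong-≋ (λ j → x[y-z]≈xy-xz (M i (sel j)) (δ a j) (δ b j)) ⟩
      sum (λ j → M i (sel j) * δ a j - M i (sel j) * δ b j)
        ≈⟨ ∑-distrib-− (λ j → M i (sel j) * δ a j) (λ j → M i (sel j) * δ b j) ⟩
      sum (λ j → M i (sel j) * δ a j) - sum (λ j → M i (sel j) * δ b j)
        ≈⟨ +-cong (sum-*δ (M i ∘ sel) a) (-‿cong (sum-*δ (M i ∘ sel) b)) ⟩
      M i (sel a) - M i (sel b)
        ≡⟨ ≡.cong (λ w → M i w - M i (sel b)) sela≡selb ⟩
      M i (sel b) - M i (sel b)
        ≈⟨ -‿inverseʳ _ ⟩
      0# ∎
    1≈0 : 1# ≈ 0#
    1≈0 = x∙y⁻¹≈ε⇒x≈y 1# 0# (begin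
      1# - 0# ≡⟨ ≡.cong₂ _-_ (δ-diag a) (δ-offDiag (a≢b ∘ ≡.sym)) ⟨
      γ a     ≈⟨ independent γ kernel a ⟩
      0#      ∎)

  independent⇒injective : ∀ {r s t} (M : Matrix F r s) (sel : Fin t → Fin s) →
    ColumnsIndependent F (selectCols F M sel) → Injective _≡_ _≡_ sel
  independent⇒injective M sel independent {a} {b} sela≡selb with a ≟ b
  ... | yes a≡b = a≡b
  ... | no  a≢b = contradiction independent (repeatedColumn⇒dependent M sel a≢b sela≡selb)

  independent-permute : ∀ {r s} (M : Matrix F r s) (σ : Permutation s s) →
    ColumnsIndependent F (selectCols F M (σ ⟨$⟩ʳ_)) → ColumnsIndependent F M
  independent-permute M σ independent γ kernel w = begin
    γ w               ≡⟨ ≡.cong γ (Perm.inverseʳ σ) ⟨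
    γ (σ ⟨$⟩ʳ σ⁻¹w)   ≈⟨ independent (γ ∘ (σ ⟨$⟩ʳ_)) permutedKernel σ⁻¹w ⟩
    0#                ∎
    where
    σ⁻¹w : Fin _
    σ⁻¹w = σ ⟨$⟩ˡ w
    permutedKernel : ∀ i → (selectCols F M (σ ⟨$⟩ʳ_) ⊙ (γ ∘ (σ ⟨$⟩ʳ_))) i ≈ 0#
    permutedKernel i = trans (sym (sum-permute (λ w → M i w * γ w) σ)) (kernel i)

  HasRank⇒independent : ∀ {r s} (M : Matrix F r s) → HasRank F M s → ColumnsIndependent F M
  HasRank⇒independent M ((sel , independent) , _) =
    independent-permute M (injective⇒permutation (independent⇒injective M sel independent)) independent

  independent⇒HasRank : ∀ {r s} (M : Matrix F r s) → ColumnsIndependent F M → HasRank F M s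
  independent⇒HasRank {s = s} M independent = ((λ j → j) , independent) , noMore
    where
    noMore : ∀ (sel : Fin (suc s) → Fin s) → ¬ ColumnsIndependent F (selectCols F M sel)
    noMore sel with pigeonhole (n<1+n s) sel
    ... | a , b , a<b , sela≡selb = repeatedColumn⇒dependent M sel (<⇒≢ a<b) sela≡selb

  forcing-vanishesOnZ : ∀ {k m} (A : Matrix F (k ℕ.+ m) (k ℕ.+ m)) (π : ChronList F {k} {m} A) b →
    ∀ (w : Fin k) → forcing F A π b (w ↑ˡ m) ≡ 0#
  forcing-vanishesOnZ {k} {m} A π b =
    foldl-preserves VanishesOnZ _ (λ x t → preserved x t) (const 0#) (λ t → t) (λ _ → ≡.refl)
    where
    open ChronList π
    VanishesOnZ : Vector Carrier (k ℕ.+ m) → Set c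
    VanishesOnZ x = ∀ w → x (w ↑ˡ m) ≡ 0#
    order≢Z : ∀ t (w : Fin k) → w ↑ˡ m ≢ order t
    order≢Z t w eq = order-notInZ t (≡.subst (InZ F) eq
      (≡.subst (ℕ._< k) (≡.sym (toℕ-↑ˡ w m)) (toℕ<n w)))
    preserved : ∀ x t {f} → VanishesOnZ x → VanishesOnZ (updateAt x (order t) f)
    preserved x t x≈0 w = ≡.trans (updateAt-minimal (w ↑ˡ m) (order t) x (order≢Z t w)) (x≈0 w)

  module _ {k m p : ℕ} (A : Matrix F (k ℕ.+ m) (k ℕ.+ m)) (π : ChronList F {k} {m} A) (p≤k : p ≤ k) where

    residual-independent :
      ColumnsIndependent F (selectCols F A (joinCols F m p≤k)) →
      ColumnsIndependent F (λ i j → residual F A π (column F A (firstCols F m p≤k j)) i)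
    residual-independent joinIndependent γ kernel j = begin
      γ j               ≡⟨ lookup-++ˡ γ z j ⟨
      (γ ++ z) (j ↑ˡ m) ≈⟨ joinIndependent (γ ++ z) joinKernel (j ↑ˡ m) ⟩
      0#                ∎
      where
      A₁ : Matrix F (k ℕ.+ m) p
      A₁ = selectCols F A (firstCols F m p≤k)
      A″ : Matrix F (k ℕ.+ m) m
      A″ = selectCols F A (lastCols F k)
      X : Matrix F (k ℕ.+ m) p
      X w j = forcing F A π (column F A (firstCols F m p≤k j)) w
      y : Vector Carrier (k ℕ.+ m)
      y = X ⊙ γ
      z : Vector Carrier m
      z l = - y (k ↑ʳ l)
      y-vanishesOnZ : ∀ w → y (w ↑ˡ m) ≈ 0#
      y-vanishesOnZ w = sum-zero (λ j → trans
        (*-congʳ (reflexive (forcing-vanishesOnZ A π (column F A (firstCols F m p≤k j)) w)))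
        (zeroˡ (γ j)))
      joinKernel : ∀ i → (selectCols F A (joinCols F m p≤k) ⊙ (γ ++ z)) i ≈ 0#
      joinKernel i = begin
        (selectCols F A (joinCols F m p≤k) ⊙ (γ ++ z)) i
          ≈⟨ ⊙-++ A (firstCols F m p≤k) (lastCols F k) γ z i ⟩
        (A₁ ⊙ γ) i + (A″ ⊙ z) i
          ≈⟨ +-congˡ (⊙-neg A″ (y ∘ lastCols F k) i) ⟩
        (A₁ ⊙ γ) i - (A″ ⊙ (y ∘ lastCols F k)) i
          ≈⟨ +-congˡ (-‿cong (⊙-vanishingOnFirst k A y y-vanishesOnZ i)) ⟨
        (A₁ ⊙ γ) i - (A ⊙ y) i
          ≈⟨ +-congˡ (-‿cong (⊙-assoc A X γ i)) ⟨
        (A₁ ⊙ γ) i - ((λ i′ j → (A ⊙ column F X j) i′) ⊙ γ) i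
          ≈⟨ ⊙-distrib-− A₁ (λ i′ j → (A ⊙ column F X j) i′) γ i ⟨
        ((λ i′ j → residual F A π (column F A (firstCols F m p≤k j)) i′) ⊙ γ) i
          ≈⟨ kernel i ⟩
        0# ∎

open import Data.Nat using (_+_)

lemma3 : ∀ {c ℓ} (F : Field c ℓ) (k m p r : ℕ)
           (A : Matrix F (k + m) (k + m)) (π : ChronList F {k} {m} A)
           (p≤k : p ≤ k) →
           HasRank F A r →
           r ≡ p + m →
           HasRank F (selectCols F A (firstCols F m p≤k)) p →
           HasRank F (selectCols F A (joinCols F m p≤k)) r →
           HasRank F (λ i j → residual F {k} {m} A π (column F A (firstCols F m p≤k j)) i) p
lemma3 F k m p .(p + m) A π p≤k _ ≡.refl _ joinRank =
  independent⇒HasRank F _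
    (residual-independent F A π p≤k (HasRank⇒independent F _ joinRank))
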